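{- Let $G$ be a graph, $k$ a positive integer, $c$ a $k$-colouring of $G$, and $u\in V(G)$. Then $D_c$ is an independent set of $\mathcal{K}_k(G)$, and no vertex of $D_c$ has a neighbour in $C_{c,u}$.
   Context: A (proper) $k$-colouring of $G$ is a map $V(G)\to[k]$ giving adjacent vertices different colours. A Kempe swap, for colours $i\neq j$, exchanges $i$ and $j$ on one connected component of the subgraph induced by the vertices coloured $i$ or $j$; it is trivial if it changes exactly one vertex and non-trivial otherwise. $\mathcal{K}_k(G)$ is the graph on the $k$-colourings of $G$, two adjacent iff they differ by one Kempe swap. $C_{c,w}$ is the set of $k$-colourings differing from $c$ exactly at the vertex $w$. $D_c$ is the set of neighbours of $c$ in $\mathcal{K}_k(G)$ obtained from $c$ by a non-trivial Kempe swap (i.e. the neighbours of $c$ not lying in any $C_{c,w}$). -}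

module Defs where

open import Data.Nat using (ℕ)
open import Data.Fin using (Fin)
open import Data.Product using (Σ; ∃; _×_; _,_; proj₁)
open import Data.Sum using (_⊎_)
open import Relation.Nullary using (¬_)
open import Relation.Binary.PropositionalEquality using (_≡_; _≢_)

record Graph (n : ℕ) : Set₁ where
  field
    E     : Fin n → Fin n → Set
    sym   : ∀ {u v} → E u v → E v u
    irrefl : ∀ {v} → ¬ E v v
open Graph public

Proper : ∀ {n} (G : Graph n) (k : ℕ) → (Fin n → Fin k) → Set
Proper G k f = ∀ u v → E G u v → f u ≢ f v

Colouring : ∀ {n} (G : Graph n) (k : ℕ) → Set
Colouring {n} G k = Σ (Fin n → Fin k) (Proper G k)

col : ∀ {n} {G : Graph n} {k} → Colouring G k → Fin n → Fin k
col = proj₁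

InIJ : ∀ {n k} → (Fin n → Fin k) → Fin k → Fin k → Fin n → Set
InIJ f i j v = f v ≡ i ⊎ f v ≡ j

data Reach {n k} (G : Graph n) (f : Fin n → Fin k) (i j : Fin k) (w : Fin n) : Fin n → Set where
  here : InIJ f i j w → Reach G f i j w w
  step : ∀ {v x} → Reach G f i j w v → E G v x → InIJ f i j x → Reach G f i j w x

KempeSwap : ∀ {n k} (G : Graph n) → (Fin n → Fin k) → (Fin n → Fin k) → Set
KempeSwap {n} {k} G f g =
  Σ (Fin k) λ i → Σ (Fin k) λ j → Σ (Fin n) λ w →
    i ≢ j × InIJ f i j w ×
    (∀ v → (Reach G f i j w v → (f v ≡ i → g v ≡ j) × (f v ≡ j → g v ≡ i))
         × (¬ Reach G f i j w v → g v ≡ f v))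

KAdj : ∀ {n} (G : Graph n) (k : ℕ) → Colouring G k → Colouring G k → Set
KAdj G k a b = KempeSwap G (col {G = G} {k} a) (col {G = G} {k} b)

InC : ∀ {n} (G : Graph n) (k : ℕ) → Colouring G k → Fin n → Colouring G k → Set
InC G k c w d = (proj₁ d w ≢ proj₁ c w) × (∀ x → x ≢ w → proj₁ d x ≡ proj₁ c x)

InD : ∀ {n} (G : Graph n) (k : ℕ) → Colouring G k → Colouring G k → Set
InD {n} G k c d = KAdj G k c d × (∀ (w : Fin n) → ¬ InC G k c w d)

{-# OPTIONS --safe #-}
module Submission where

-- Let d arise from c by swapping a component K of the (i,j)-subgraph that has at least two
-- vertices, and let d → e swap a component M of the (p,q)-subgraph of d. If M covers K, two
-- adjacent vertices of K force {p,q} = {i,j}; as the (i,j)-components of d are those of c,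
-- M = K and e = c. In both parts of the theorem e ≠ c, and a vertex of K outside M leads to a
-- contradiction (for e ∈ C_{c,u} through a neighbour of u in K).
-- Membership in a component is undecidable here, so case splits on it happen under double
-- negation; every goal is negative or an equality of colours, hence stable.

open import Defs renaming (sym to E-sym)
open import Data.Nat using (ℕ; _≤_)
open import Data.Fin using (Fin)
open import Data.Fin.Properties using (_≟_)
open import Data.Product using (_×_; _,_; proj₁; proj₂; ∃-syntax)
open import Data.Sum using (_⊎_; inj₁; inj₂; [_,_]′)
open import Relation.Nullary using (¬_; yes; no; contradiction)
open import Relation.Nullary.Negation.Core using (Stable)
open import Relation.Nullary.Decidable.Core using (decidable-stable; ¬¬-excluded-middle)
open import Relation.Binary.PropositionalEquality
  using (_≡_; _≢_; refl; sym; trans; subst)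

module _ {A : Set} where

  OneOf : A → A → A → Set
  OneOf i j α = α ≡ i ⊎ α ≡ j

  Swaps : A → A → A → A → Set
  Swaps i j α β = (α ≡ i → β ≡ j) × (α ≡ j → β ≡ i)

  SamePair : A → A → A → A → Set
  SamePair i j p q = (p ≡ i × q ≡ j) ⊎ (p ≡ j × q ≡ i)

  samePair-sym : ∀ {i j p q} → SamePair i j p q → SamePair p q i j
  samePair-sym (inj₁ (refl , refl)) = inj₁ (refl , refl)
  samePair-sym (inj₂ (refl , refl)) = inj₂ (refl , refl)

  oneOf-samePair : ∀ {i j p q α} → SamePair i j p q → OneOf p q α → OneOf i j α
  oneOf-samePair (inj₁ (refl , refl)) α∈pq = α∈pq
  oneOf-samePair (inj₂ (refl , refl)) (inj₁ α≡j) = inj₂ α≡j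
  oneOf-samePair (inj₂ (refl , refl)) (inj₂ α≡i) = inj₁ α≡i

  swap-oneOf : ∀ {i j α β} → OneOf i j α → Swaps i j α β → OneOf i j β
  swap-oneOf (inj₁ refl) (i↦j , _) = inj₂ (i↦j refl)
  swap-oneOf (inj₂ refl) (_ , j↦i) = inj₁ (j↦i refl)

  swap-≢ : ∀ {i j α β} → i ≢ j → OneOf i j α → Swaps i j α β → β ≢ α
  swap-≢ i≢j (inj₁ refl) (i↦j , _) β≡i = i≢j (trans (sym β≡i) (i↦j refl))
  swap-≢ i≢j (inj₂ refl) (_ , j↦i) β≡j = i≢j (trans (sym (j↦i refl)) β≡j)

  swap-sym : ∀ {i j α β} → i ≢ j → OneOf i j α → Swaps i j α β → Swaps i j β α
  swap-sym i≢j (inj₁ refl) (i↦j , _) =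
    (λ β≡i → contradiction (trans (sym β≡i) (i↦j refl)) i≢j) , (λ _ → refl)
  swap-sym i≢j (inj₂ refl) (_ , j↦i) =
    (λ _ → refl) , (λ β≡j → contradiction (trans (sym (j↦i refl)) β≡j) i≢j)

  swaps-samePair : ∀ {i j p q α β} → SamePair i j p q → Swaps p q α β → Swaps i j α β
  swaps-samePair (inj₁ (refl , refl)) p↔q = p↔q
  swaps-samePair (inj₂ (refl , refl)) (j↦i , i↦j) = i↦j , j↦i

  swap-functional : ∀ {i j α β γ} → OneOf i j α → Swaps i j α β → Swaps i j α γ → β ≡ γ
  swap-functional (inj₁ refl) (i↦β , _) (i↦γ , _) = trans (i↦β refl) (sym (i↦γ refl))
  swap-functional (inj₂ refl) (_ , j↦β) (_ , j↦γ) = trans (j↦β refl) (sym (j↦γ refl))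

  samePair-of-swaps : ∀ {i j p q α β} →
    OneOf i j α → OneOf p q α → Swaps i j α β → Swaps p q α β → SamePair i j p q
  samePair-of-swaps (inj₁ refl) (inj₁ refl) (i↦j , _) (p↦q , _) =
    inj₁ (refl , trans (sym (p↦q refl)) (i↦j refl))
  samePair-of-swaps (inj₁ refl) (inj₂ refl) (i↦j , _) (_ , q↦p) =
    inj₂ (trans (sym (q↦p refl)) (i↦j refl) , refl)
  samePair-of-swaps (inj₂ refl) (inj₁ refl) (_ , j↦i) (p↦q , _) =
    inj₂ (refl , trans (sym (p↦q refl)) (j↦i refl))
  samePair-of-swaps (inj₂ refl) (inj₂ refl) (_ , j↦i) (_ , q↦p) =
    inj₁ (trans (sym (q↦p refl)) (j↦i refl) , refl)

  samePair-of-distinct : ∀ {i j p q α β} → α ≢ β →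
    OneOf i j α → OneOf i j β → OneOf p q α → OneOf p q β → SamePair i j p q
  samePair-of-distinct α≢β (inj₁ refl) (inj₁ refl) _ _ = contradiction refl α≢β
  samePair-of-distinct α≢β (inj₂ refl) (inj₂ refl) _ _ = contradiction refl α≢β
  samePair-of-distinct α≢β _ _ (inj₁ refl) (inj₁ refl) = contradiction refl α≢β
  samePair-of-distinct α≢β _ _ (inj₂ refl) (inj₂ refl) = contradiction refl α≢β
  samePair-of-distinct _ (inj₁ refl) (inj₂ refl) (inj₁ refl) (inj₂ refl) = inj₁ (refl , refl)
  samePair-of-distinct _ (inj₁ refl) (inj₂ refl) (inj₂ refl) (inj₁ refl) = inj₂ (refl , refl)
  samePair-of-distinct _ (inj₂ refl) (inj₁ refl) (inj₁ refl) (inj₂ refl) = inj₂ (refl , refl)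
  samePair-of-distinct _ (inj₂ refl) (inj₁ refl) (inj₂ refl) (inj₁ refl) = inj₁ (refl , refl)

module _ {n k : ℕ} {G : Graph n} where

  ≡-stable : {α β : Fin k} → Stable (α ≡ β)
  ≡-stable {α} {β} = decidable-stable (α ≟ β)

  Reach-oneOf : ∀ {f : Fin n → Fin k} {i j w v} → Reach G f i j w v → InIJ f i j v
  Reach-oneOf (here v∈ij) = v∈ij
  Reach-oneOf (step _ _ v∈ij) = v∈ij

  Reach-trans : ∀ {f : Fin n → Fin k} {i j u v x} →
    Reach G f i j u v → Reach G f i j v x → Reach G f i j u x
  Reach-trans u~v (here _) = u~v
  Reach-trans u~v (step v~y y~x x∈ij) = step (Reach-trans u~v v~y) y~x x∈ij

  Reach-sym : ∀ {f : Fin n → Fin k} {i j u v} → Reach G f i j u v → Reach G f i j v u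
  Reach-sym (here u∈ij) = here u∈ij
  Reach-sym (step u~y y~v v∈ij) =
    Reach-trans (step (here v∈ij) (E-sym G y~v) (Reach-oneOf u~y)) (Reach-sym u~y)

  Reach-map : ∀ {f g : Fin n → Fin k} {i j p q u v} →
    (∀ x → InIJ f i j x → InIJ g p q x) → Reach G f i j u v → Reach G g p q u v
  Reach-map f⊆g (here u∈ij) = here (f⊆g _ u∈ij)
  Reach-map f⊆g (step u~y y~v v∈ij) = step (Reach-map f⊆g u~y) y~v (f⊆g _ v∈ij)

  Reach-samePair : ∀ {f : Fin n → Fin k} {i j p q u v} →
    SamePair i j p q → Reach G f p q u v → Reach G f i j u v
  Reach-samePair ij≈pq = Reach-map (λ _ → oneOf-samePair ij≈pq)

  Reach-first-step : ∀ {f : Fin n → Fin k} {i j u v} →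
    Reach G f i j u v → v ≡ u ⊎ ∃[ z ] (E G u z × InIJ f i j z)
  Reach-first-step (here _) = inj₁ refl
  Reach-first-step (step u~y y~v v∈ij) with Reach-first-step u~y
  ... | inj₁ refl = inj₂ (_ , y~v , v∈ij)
  ... | inj₂ first = inj₂ first

  SwapsOn : (f g : Fin n → Fin k) → Fin k → Fin k → Fin n → Set
  SwapsOn f g i j w = ∀ v →
    (Reach G f i j w v → Swaps i j (f v) (g v)) × (¬ Reach G f i j w v → g v ≡ f v)

  DiffersOnlyAt : (f : Fin n → Fin k) → Fin n → (g : Fin n → Fin k) → Set
  DiffersOnlyAt f u g = (g u ≢ f u) × (∀ x → x ≢ u → g x ≡ f x)

  module _ {f g : Fin n → Fin k} {i j w} (f↝g : SwapsOn f g i j w) where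

    swapped : ∀ {v} → Reach G f i j w v → Swaps i j (f v) (g v)
    swapped {v} = proj₁ (f↝g v)

    unchanged : ∀ {v} → ¬ Reach G f i j w v → g v ≡ f v
    unchanged {v} = proj₂ (f↝g v)

    changed : ∀ {v} → i ≢ j → Reach G f i j w v → g v ≢ f v
    changed i≢j w~v = swap-≢ i≢j (Reach-oneOf w~v) (swapped w~v)

    Reach-after-swap : ∀ {v} → Reach G f i j w v → Reach G g i j w v
    Reach-after-swap w~v@(here w∈ij) = here (swap-oneOf w∈ij (swapped w~v))
    Reach-after-swap w~v@(step w~y y~v v∈ij) =
      step (Reach-after-swap w~y) y~v (swap-oneOf v∈ij (swapped w~v))

    oneOf-before-swap : ∀ {x} → InIJ g i j x → InIJ f i j x
    oneOf-before-swap {x} gx∈ij with f x ≟ i | f x ≟ j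
    ... | yes fx≡i | _ = inj₁ fx≡i
    ... | no _ | yes fx≡j = inj₂ fx≡j
    ... | no fx≢i | no fx≢j =
      subst (OneOf i j) (unchanged (λ w~x → [ fx≢i , fx≢j ]′ (Reach-oneOf w~x))) gx∈ij

    Reach-before-swap : ∀ {u v} → Reach G g i j u v → Reach G f i j u v
    Reach-before-swap = Reach-map (λ _ → oneOf-before-swap)

    SwapsOn-sym : i ≢ j → SwapsOn g f i j w
    SwapsOn-sym i≢j v =
      (λ w~v → let w~ᶠv = Reach-before-swap w~v in
        swap-sym i≢j (Reach-oneOf w~ᶠv) (swapped w~ᶠv)) ,
      (λ ¬w~v → ≡-stable λ fv≢gv → ¬¬-excluded-middle λ
        { (yes w~ᶠv) → ¬w~v (Reach-after-swap w~ᶠv)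
        ; (no ¬w~ᶠv) → fv≢gv (sym (unchanged ¬w~ᶠv)) })

    nontrivial-swap-has-edge : ∀ {u} → i ≢ j → ¬ DiffersOnlyAt f u g → Reach G f i j w u →
      ¬ (∀ z → E G u z → ¬ Reach G f i j w z)
    nontrivial-swap-has-edge {u} i≢j nontrivial w~u isolated =
      nontrivial (changed i≢j w~u , only-u)
      where
      only-u : ∀ x → x ≢ u → g x ≡ f x
      only-u x x≢u = ≡-stable λ gx≢fx → ¬¬-excluded-middle λ
        { (no ¬w~x) → gx≢fx (unchanged ¬w~x)
        ; (yes w~x) → [ x≢u , (λ (z , u-z , z∈ij) → isolated z u-z (step w~u u-z z∈ij)) ]′
                        (Reach-first-step (Reach-trans (Reach-sym w~u) w~x)) }

  swap-determined : ∀ {f g h : Fin n → Fin k} {i j p q w w′} →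
    SamePair i j p q → Reach G f i j w w′ → SwapsOn f g i j w → SwapsOn f h p q w′ →
    ∀ x → g x ≡ h x
  swap-determined ij≈pq w~w′ f↝g f↝h x = ≡-stable λ gx≢hx → ¬¬-excluded-middle λ
    { (yes w~x) → gx≢hx (swap-functional (Reach-oneOf w~x) (swapped f↝g w~x)
        (swaps-samePair ij≈pq (swapped f↝h
          (Reach-samePair (samePair-sym ij≈pq) (Reach-trans (Reach-sym w~w′) w~x)))))
    ; (no ¬w~x) → gx≢hx (trans (unchanged f↝g ¬w~x)
        (sym (unchanged f↝h λ w′~x → ¬w~x (Reach-trans w~w′ (Reach-samePair ij≈pq w′~x))))) }

  covering-swap-undoes : ∀ {c d e : Fin n → Fin k} {i j p q w w′} →
    Proper G k d → i ≢ j → InIJ c i j w → SwapsOn c d i j w → ¬ DiffersOnlyAt c w d →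
    SwapsOn d e p q w′ → (∀ v → Reach G c i j w v → ¬ ¬ Reach G d p q w′ v) →
    ∀ x → e x ≡ c x
  covering-swap-undoes {c} {d} {e} {i} {j} {p} {q} {w} {w′}
    d-proper i≢j w∈ij c↝d nontrivial d↝e K⊆M x =
    ≡-stable λ ex≢cx → same-pair λ ij≈pq → K⊆M w (here w∈ij) λ w′~w →
      ex≢cx (sym (swap-determined ij≈pq (Reach-sym (Reach-samePair ij≈pq w′~w))
                                  (SwapsOn-sym c↝d i≢j) d↝e x))
    where
    same-pair : ¬ ¬ SamePair i j p q
    same-pair ¬ij≈pq = nontrivial-swap-has-edge c↝d i≢j nontrivial (here w∈ij) λ y w-y w~y →
      K⊆M w (here w∈ij) λ w′~w → K⊆M y w~y λ w′~y →
        ¬ij≈pq (samePair-of-distinct (d-proper w y w-y)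
          (swap-oneOf w∈ij (swapped c↝d (here w∈ij)))
          (swap-oneOf (Reach-oneOf w~y) (swapped c↝d w~y))
          (Reach-oneOf w′~w) (Reach-oneOf w′~y))

  InD-no-triangle : ∀ (c d e : Colouring G k) → InD G k c d → KAdj G k c e → ¬ KAdj G k d e
  InD-no-triangle (c , _) (d , d-proper) (e , _)
    ((i , j , w , i≢j , w∈ij , c↝d) , nontrivial) (a , b , w′ , a≢b , w′∈ab , c↝e)
    (p , q , w″ , p≢q , w″∈pq , d↝e) =
    changed c↝e a≢b (here w′∈ab)
      (covering-swap-undoes d-proper i≢j w∈ij c↝d (nontrivial w) d↝e K⊆M w′)
    where
    K⊆M : ∀ v → Reach G c i j w v → ¬ ¬ Reach G d p q w″ v
    K⊆M v w~v ¬w″~v = ¬¬-excluded-middle λ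
      { (no ¬w′~v) → changed c↝d i≢j w~v (trans (sym (unchanged d↝e ¬w″~v)) (unchanged c↝e ¬w′~v))
      ; (yes w′~v) → distinct-swaps (samePair-of-swaps (Reach-oneOf w~v) (Reach-oneOf w′~v)
          (swapped c↝d w~v) (subst (Swaps a b (c v)) (unchanged d↝e ¬w″~v) (swapped c↝e w′~v))) w′~v }
      where
      distinct-swaps : SamePair i j a b → ¬ Reach G c a b w′ v
      distinct-swaps ij≈ab w′~v = changed d↝e p≢q (here w″∈pq) (sym (swap-determined ij≈ab
        (Reach-trans w~v (Reach-sym (Reach-samePair ij≈ab w′~v))) c↝d c↝e w″))

  InD-not-adjacent-to-InC : ∀ (c d e : Colouring G k) {u} →
    InD G k c d → InC G k c u e → ¬ KAdj G k d e
  InD-not-adjacent-to-InC (c , _) (d , d-proper) (e , _) {u}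
    ((i , j , w , i≢j , w∈ij , c↝d) , nontrivial) (eu≢cu , e≡c-off-u)
    (p , q , w′ , p≢q , w′∈pq , d↝e) =
    eu≢cu (covering-swap-undoes d-proper i≢j w∈ij c↝d (nontrivial w) d↝e K⊆M u)
    where
    only-u : ∀ {v} → Reach G c i j w v → ¬ Reach G d p q w′ v → v ≡ u
    only-u w~v ¬w′~v = decidable-stable (_ ≟ u) λ v≢u →
      changed c↝d i≢j w~v (trans (sym (unchanged d↝e ¬w′~v)) (e≡c-off-u _ v≢u))

    K⊆M : ∀ v → Reach G c i j w v → ¬ ¬ Reach G d p q w′ v
    K⊆M v w~v ¬w′~v with only-u w~v ¬w′~v
    ... | refl = nontrivial-swap-has-edge c↝d i≢j (nontrivial u) w~v λ z u-z w~z →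
      let z≢u = λ z≡u → irrefl G (subst (E G u) z≡u u-z) in
      ¬¬-excluded-middle λ
        { (no ¬w′~z) → z≢u (only-u w~z ¬w′~z)
        ; (yes w′~z) → ¬w′~v (step w′~z (E-sym G u-z)
            (oneOf-samePair (samePair-sym (ij≈pq w~z w′~z z≢u)) du∈ij)) }
      where
      du∈ij : OneOf i j (d u)
      du∈ij = swap-oneOf (Reach-oneOf w~v) (swapped c↝d w~v)

      ij≈pq : ∀ {z} → Reach G c i j w z → Reach G d p q w′ z → z ≢ u → SamePair i j p q
      ij≈pq {z} w~z w′~z z≢u =
        samePair-of-swaps (swap-oneOf (Reach-oneOf w~z) (swapped c↝d w~z)) (Reach-oneOf w′~z)
          (swap-sym i≢j (Reach-oneOf w~z) (swapped c↝d w~z))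
          (subst (Swaps p q (d z)) (e≡c-off-u z z≢u) (swapped d↝e w′~z))

lemma3p2 : ∀ {n} (G : Graph n) (k : ℕ) → 1 ≤ k → (c : Colouring G k) (u : Fin n) →
    (∀ (d₁ d₂ : Colouring G k) → InD G k c d₁ → InD G k c d₂ → ¬ KAdj G k d₁ d₂)
    × (∀ (d e : Colouring G k) → InD G k c d → InC G k c u e → ¬ KAdj G k d e)
lemma3p2 G k _ c u =
  (λ d₁ d₂ d₁∈D d₂∈D → InD-no-triangle c d₁ d₂ d₁∈D (proj₁ d₂∈D)) ,
  (λ d e → InD-not-adjacent-to-InC c d e)
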